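{- Let $\mathcal{H}$ be a connected hypergraph whose longest Berge path has length $k$. If $\mathcal{H}$ contains a Berge cycle $C$ of length $k+1$, then $V(\mathcal{H})=V(C)$, and $p_{\mathcal{H}}(e)=k$ for every edge $e\in E(\mathcal{H})$.
   Context: Hypergraphs are simple. A Berge path of length $k$ is an alternating sequence $v_0e_1v_1\cdots v_{k-1}e_kv_k$ of distinct vertices and distinct edges with $v_{i-1},v_i\in e_i$ for all $i$. A Berge cycle of length $k$ is an alternating sequence $v_0e_1v_1e_2\cdots v_{k-1}e_kv_0$ of distinct vertices $v_0,\dots,v_{k-1}$ and distinct edges $e_1,\dots,e_k$ with $v_{i-1},v_i\in e_i$ (indices mod $k$); $V(C)=\{v_0,\dots,v_{k-1}\}$ is its set of defining vertices. A hypergraph is connected if every two distinct vertices are the terminal vertices of some Berge path. $p_{\mathcal{H}}(e)$ is the maximum length of a Berge path in $\mathcal{H}$ having $e$ as one of its edges. -}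

module Defs where

open import Data.Nat using (ℕ; zero; suc; _≤_; _<?_)
open import Data.Fin using (Fin; zero; suc; toℕ; fromℕ<; inject₁)
open import Data.Fin.Subset using (Subset; _∈_; ∣_∣)
open import Data.Product using (Σ; _×_; ∃; ∃-syntax; _,_)
open import Relation.Nullary using (yes; no; ¬_)
open import Relation.Binary.PropositionalEquality using (_≡_)
open import Function.Definitions using (Injective)

record Hypergraph : Set where
  field
    n : ℕ
    m : ℕ
    edge : Fin m → Subset n
    edge-inj : Injective _≡_ _≡_ edge
    edge-size : ∀ j → 2 ≤ ∣ edge j ∣

open Hypergraph public

record BergePath (H : Hypergraph) (k : ℕ) : Set where
  field
    vtx : Fin (suc k) → Fin (n H)
    edg : Fin k → Fin (m H)
    vtx-inj : Injective _≡_ _≡_ vtx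
    edg-inj : Injective _≡_ _≡_ edg
    inc : ∀ i → (vtx (inject₁ i) ∈ edge H (edg i)) × (vtx (suc i) ∈ edge H (edg i))

open BergePath public

cnext : ∀ {k} → Fin k → Fin k
cnext {suc k} i with suc (toℕ i) <? suc k
... | yes p = fromℕ< p
... | no _ = zero

record BergeCycle (H : Hypergraph) (k : ℕ) : Set where
  field
    len≥2 : 2 ≤ k
    cvtx : Fin k → Fin (n H)
    cedg : Fin k → Fin (m H)
    cvtx-inj : Injective _≡_ _≡_ cvtx
    cedg-inj : Injective _≡_ _≡_ cedg
    cinc : ∀ i → (cvtx i ∈ edge H (cedg i)) × (cvtx (cnext i) ∈ edge H (cedg i))

open BergeCycle public

_∈V_ : ∀ {H k} → Fin (n H) → BergeCycle H k → Set
v ∈V C = ∃[ i ] cvtx C i ≡ v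

Connected : Hypergraph → Set
Connected H = ∀ (x y : Fin (n H)) → ¬ (x ≡ y) →
  ∃[ k ] Σ (BergePath H k) λ P → (vtx P zero ≡ x) × (vtx P (Data.Fin.fromℕ k) ≡ y)

LongestPathLength : Hypergraph → ℕ → Set
LongestPathLength H k = BergePath H k × (∀ l → BergePath H l → l ≤ k)

Uses : ∀ {H k} → BergePath H k → Fin (m H) → Set
Uses P e = ∃[ i ] edg P i ≡ e

pH≡ : (H : Hypergraph) → Fin (m H) → ℕ → Set
pH≡ H e k = (Σ (BergePath H k) λ P → Uses P e)
          × (∀ l (P : BergePath H l) → Uses P e → l ≤ k)

module Submission where

-- Read the cycle C = c₀ E₀ c₁ … c_k E_k c₀ as a (k+1)-periodic sequence, so that any k
-- consecutive steps of it form a Berge path of length k (an arc).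
-- If some vertex lies off C, connectivity yields an edge f containing a vertex u off C and a
-- vertex of C; prefixing u f to an arc of length k that avoids f (if f = Eₓ, start at cₓ₊₁)
-- gives a Berge path of length k + 1, which is too long. Hence V(H) = V(C).
-- A cycle edge lies on an arc of length k. Any other edge e contains two cycle vertices cᵢ, cⱼ
-- with i < j, and cⱼ₊₁ … c_{i+k+1} = cᵢ, e, cⱼ, cⱼ₋₁ … cᵢ₊₁ is a Berge path of length k
-- through e.

open import Defs
open import Data.Empty using (⊥; ⊥-elim)
open import Data.Fin using (Fin; zero; suc; toℕ; fromℕ; fromℕ<; inject₁)
open import Data.Fin.Properties
  using (toℕ-injective; toℕ<n; toℕ-fromℕ<; toℕ-inject₁; any?)
  renaming (_≟_ to _≟ᶠ_; suc-injective to fsuc-injective)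
open import Data.Fin.Subset using (Subset; _∈_; ∣_∣; inside; outside; Nonempty)
open import Data.Nat
  using (ℕ; zero; suc; _+_; _*_; _∸_; _≤_; _<_; z≤n; s≤s; s≤s⁻¹; z<s; s<s; NonZero; _<?_)
open import Data.Nat.DivMod
  using ( _%_; _/_; _mod_; m≡m%n+[m/n]*n; m%n<n; m%n%n≡m%n; m<n⇒m%n≡m; n%n≡0
        ; [m+n]%n≡m%n; %-distribˡ-+; /-monoˡ-≤)
open import Data.Nat.Properties
open import Data.Product using (Σ; ∃₂; ∃-syntax; _×_; _,_; proj₁; proj₂; swap)
open import Data.Sum using ([_,_]′)
open import Data.Vec.Base using (_∷_; here; there)
open import Function using (_∘_)
open import Relation.Nullary using (¬_; Dec; yes; no; contradiction)
open import Relation.Binary using (tri<; tri≈; tri>)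
open import Relation.Binary.PropositionalEquality

0<∣p∣⇒Nonempty : ∀ {n} (p : Subset n) → 0 < ∣ p ∣ → Nonempty p
0<∣p∣⇒Nonempty (inside  ∷ p) _     = zero , here
0<∣p∣⇒Nonempty (outside ∷ p) 0<∣p∣ =
  let x , x∈p = 0<∣p∣⇒Nonempty p 0<∣p∣ in suc x , there x∈p

1<∣p∣⇒∃≢ : ∀ {n} (p : Subset n) → 1 < ∣ p ∣ → ∃₂ λ x y → x ≢ y × x ∈ p × y ∈ p
1<∣p∣⇒∃≢ (inside  ∷ p) (s≤s 0<∣p∣) =
  let y , y∈p = 0<∣p∣⇒Nonempty p 0<∣p∣ in zero , suc y , (λ ()) , here , there y∈p
1<∣p∣⇒∃≢ (outside ∷ p) 1<∣p∣ =
  let x , y , x≢y , x∈p , y∈p = 1<∣p∣⇒∃≢ p 1<∣p∣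
  in suc x , suc y , x≢y ∘ fsuc-injective , there x∈p , there y∈p

∃-crossing : ∀ {l} {P : Fin (suc l) → Set} → (∀ x → Dec (P x)) →
             ¬ P zero → P (fromℕ l) → ∃[ i ] ¬ P (inject₁ i) × P (suc i)
∃-crossing {zero}  P? ¬P₀ Pₗ = contradiction Pₗ ¬P₀
∃-crossing {suc l} P? ¬P₀ Pₗ with P? (suc zero)
... | yes P₁  = zero , ¬P₀ , P₁
... | no  ¬P₁ = let i , ¬Pᵢ , Pᵢ₊₁ = ∃-crossing (P? ∘ suc) ¬P₁ Pₗ in suc i , ¬Pᵢ , Pᵢ₊₁

%-injective-window : ∀ N .{{_ : NonZero N}} {x y} → x ≤ y → y < x + N → x % N ≡ y % N → x ≡ y
%-injective-window N {x} {y} x≤y y<x+N x%≡y% = begin-equality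
  x                  ≡⟨ m≡m%n+[m/n]*n x N ⟩
  x % N + x / N * N  ≡⟨ cong₂ (λ r q → r + q * N) x%≡y% x/≡y/ ⟩
  y % N + y / N * N  ≡⟨ m≡m%n+[m/n]*n y N ⟨
  y                  ∎
  where
  open ≤-Reasoning
  y/<1+x/ : y / N < suc (x / N)
  y/<1+x/ = *-cancelʳ-< N _ _ (+-cancelˡ-< (y % N) _ _ (begin-strict
    y % N + y / N * N        ≡⟨ m≡m%n+[m/n]*n y N ⟨
    y                        <⟨ y<x+N ⟩
    x + N                    ≡⟨ cong (_+ N) (m≡m%n+[m/n]*n x N) ⟩
    x % N + x / N * N + N    ≡⟨ cong (λ r → r + x / N * N + N) x%≡y% ⟩
    y % N + x / N * N + N    ≡⟨ +-assoc (y % N) (x / N * N) N ⟩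
    y % N + (x / N * N + N)  ≡⟨ cong (y % N +_) (+-comm (x / N * N) N) ⟩
    y % N + suc (x / N) * N  ∎))
  x/≡y/ : x / N ≡ y / N
  x/≡y/ = ≤-antisym (/-monoˡ-≤ N x≤y) (s≤s⁻¹ y/<1+x/)

%-offset-injective : ∀ N .{{_ : NonZero N}} s {a b} → a < N → b < N →
                     (a + s) % N ≡ (b + s) % N → a ≡ b
%-offset-injective N s {a} {b} a<N b<N eq =
  [ (λ a≤b → ordered a≤b b<N eq) , (λ b≤a → sym (ordered b≤a a<N (sym eq))) ]′ (≤-total a b)
  where
  ordered : ∀ {a b} → a ≤ b → b < N → (a + s) % N ≡ (b + s) % N → a ≡ b
  ordered {a} {b} a≤b b<N = +-cancelʳ-≡ s a b ∘ %-injective-window N (+-monoˡ-≤ s a≤b) (begin-strict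
    b + s      <⟨ +-monoˡ-< s b<N ⟩
    N + s      ≡⟨ +-comm N s ⟩
    s + N      ≤⟨ +-monoˡ-≤ N (m≤n+m s a) ⟩
    a + s + N  ∎)
    where open ≤-Reasoning

module _ {A : Set} where

  InjectiveBelow : ℕ → (ℕ → A) → Set
  InjectiveBelow n f = ∀ {x y} → x < n → y < n → f x ≡ f y → x ≡ y

  DisjointBelow : ℕ → (ℕ → A) → ℕ → (ℕ → A) → Set
  DisjointBelow m f n g = ∀ {x y} → x < m → y < n → f x ≢ g y

  infixr 5 _◂_
  _◂_ : A → (ℕ → A) → ℕ → A
  (x ◂ f) zero    = x
  (x ◂ f) (suc t) = f t

  ◂-injective : ∀ {n x f} → InjectiveBelow n f → (∀ {t} → t < n → f t ≢ x) →
                InjectiveBelow (suc n) (x ◂ f)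
  ◂-injective f-inj x∉f {zero}  {zero}  _  _  _  = refl
  ◂-injective f-inj x∉f {zero}  {suc y} _  y< eq = contradiction (sym eq) (x∉f (s≤s⁻¹ y<))
  ◂-injective f-inj x∉f {suc x} {zero}  x< _  eq = contradiction eq (x∉f (s≤s⁻¹ x<))
  ◂-injective f-inj x∉f {suc x} {suc y} x< y< eq = cong suc (f-inj (s≤s⁻¹ x<) (s≤s⁻¹ y<) eq)

  splice : ℕ → (ℕ → A) → (ℕ → A) → ℕ → A
  splice zero    f g = g
  splice (suc a) f g = f zero ◂ splice a (f ∘ suc) g

  splice-< : ∀ {a f g t} → t < a → splice a f g t ≡ f t
  splice-< {suc a} {t = zero}  _   = refl
  splice-< {suc a} {t = suc t} t<a = splice-< (s≤s⁻¹ t<a)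

  splice-+ : ∀ a {f g} t → splice a f g (a + t) ≡ g t
  splice-+ zero    t = refl
  splice-+ (suc a) t = splice-+ a t

  splice-at : ∀ a {f g} → splice a f g a ≡ g zero
  splice-at zero    = refl
  splice-at (suc a) = splice-at a

  data Split (a : ℕ) : ℕ → Set where
    below : ∀ {t} → t < a → Split a t
    above : ∀ t → Split a (a + t)

  split : ∀ a t → Split a t
  split zero    t       = above t
  split (suc a) zero    = below z<s
  split (suc a) (suc t) with split a t
  ... | below t<a = below (s<s t<a)
  ... | above r   = above r

  splice-injective : ∀ {a b f g} → InjectiveBelow a f → InjectiveBelow b g →
                     DisjointBelow a f b g → InjectiveBelow (a + b) (splice a f g)
  splice-injective {a} {b} {f} {g} f-inj g-inj f∩g {x} {y} x< y< eq with split a x | split a y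
  ... | below x<a | below y<a =
    f-inj x<a y<a (trans (sym (splice-< x<a)) (trans eq (splice-< y<a)))
  ... | below x<a | above s   =
    contradiction (trans (sym (splice-< x<a)) (trans eq (splice-+ a s)))
                  (f∩g x<a (+-cancelˡ-< a _ _ y<))
  ... | above r   | below y<a =
    contradiction (trans (sym (splice-< y<a)) (trans (sym eq) (splice-+ a r)))
                  (f∩g y<a (+-cancelˡ-< a _ _ x<))
  ... | above r   | above s   =
    cong (a +_) (g-inj (+-cancelˡ-< a _ _ x<) (+-cancelˡ-< a _ _ y<)
                       (trans (sym (splice-+ a r)) (trans eq (splice-+ a s))))

module _ {A B : Set} (R : A → B → A → Set) where

  Chain : ℕ → (ℕ → A) → (ℕ → B) → Set
  Chain n v w = ∀ {t} → t < n → R (v t) (w t) (v (suc t))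

  splice-chain : ∀ {a b f g fe ge e} → Chain a f fe → R (f a) e (g zero) → Chain b g ge →
                 Chain (a + suc b) (splice (suc a) f g) (splice a fe (e ◂ ge))
  splice-chain {zero}  f-chain link g-chain {zero}  _  = link
  splice-chain {zero}  f-chain link g-chain {suc t} t< = g-chain (s≤s⁻¹ t<)
  splice-chain {suc a} f-chain link g-chain {zero}  _  = f-chain z<s
  splice-chain {suc a} f-chain link g-chain {suc t} t< =
    splice-chain (f-chain ∘ s<s) link g-chain (s≤s⁻¹ t<)

module _ (H : Hypergraph) where

  Links : Fin (n H) → Fin (m H) → Fin (n H) → Set
  Links u f v = u ∈ edge H f × v ∈ edge H f

  -- Only the values below the length matter: beyond it vtx and edg are arbitrary.
  record SeqPath (k : ℕ) : Set where
    field
      vtx     : ℕ → Fin (n H)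
      edg     : ℕ → Fin (m H)
      vtx-inj : InjectiveBelow (suc k) vtx
      edg-inj : InjectiveBelow k edg
      links   : Chain Links k vtx edg

  open SeqPath

  toBergePath : ∀ {k} → SeqPath k → BergePath H k
  toBergePath P = record
    { vtx     = vtx P ∘ toℕ
    ; edg     = edg P ∘ toℕ
    ; vtx-inj = λ {i} {j} eq → toℕ-injective (vtx-inj P (toℕ<n i) (toℕ<n j) eq)
    ; edg-inj = λ {i} {j} eq → toℕ-injective (edg-inj P (toℕ<n i) (toℕ<n j) eq)
    ; inc     = λ i → let u∈f , v∈f = links P (toℕ<n i)
                      in subst (λ t → vtx P t ∈ edge H (edg P (toℕ i))) (sym (toℕ-inject₁ i)) u∈f
                       , v∈f
    }

  toBergePath-uses : ∀ {k} (P : SeqPath k) {t e} → t < k → edg P t ≡ e → Uses (toBergePath P) e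
  toBergePath-uses P t<k eq = fromℕ< t<k , trans (cong (edg P) (toℕ-fromℕ< t<k)) eq

  prepend : ∀ {b} u f (Q : SeqPath b) → (∀ {t} → t < suc b → vtx Q t ≢ u) →
            (∀ {t} → t < b → edg Q t ≢ f) → Links u f (vtx Q zero) → SeqPath (suc b)
  prepend u f Q u∉Q f∉Q link = record
    { vtx     = u ◂ vtx Q
    ; edg     = f ◂ edg Q
    ; vtx-inj = ◂-injective (vtx-inj Q) u∉Q
    ; edg-inj = ◂-injective (edg-inj Q) f∉Q
    ; links   = λ { {zero} _ → link ; {suc t} t< → links Q (s≤s⁻¹ t<) }
    }

  reverse : ∀ {l} → SeqPath l → SeqPath l
  reverse {l} P = record
    { vtx     = λ t → vtx P (l ∸ t)
    ; edg     = λ t → edg P (l ∸ suc t)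
    ; vtx-inj = λ {x} {y} x< y< → ∸-cancelˡ-≡ (s≤s⁻¹ x<) (s≤s⁻¹ y<)
                                 ∘ vtx-inj P (s≤s (m∸n≤m l x)) (s≤s (m∸n≤m l y))
    ; edg-inj = λ x< y< → suc-injective ∘ ∸-cancelˡ-≡ x< y< ∘ edg-inj P (l∸1+t<l x<) (l∸1+t<l y<)
    ; links   = λ {t} t<l → subst (λ s → Links (vtx P s) (edg P (l ∸ suc t)) (vtx P (l ∸ suc t)))
                                  (sym (+-∸-assoc 1 t<l)) (swap (links P (l∸1+t<l t<l)))
    }
    where
    l∸1+t<l : ∀ {t} → t < l → l ∸ suc t < l
    l∸1+t<l t<l = ∸-monoʳ-< z<s t<l

  join : ∀ {a b} (P : SeqPath a) f (Q : SeqPath b) →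
         DisjointBelow (suc a) (vtx P) (suc b) (vtx Q) →
         DisjointBelow a (edg P) (suc b) (f ◂ edg Q) →
         (∀ {t} → t < b → edg Q t ≢ f) → Links (vtx P a) f (vtx Q zero) → SeqPath (a + suc b)
  join {a} P f Q Pᵥ∩Qᵥ Pₑ∩fQₑ f∉Q link = record
    { vtx     = splice (suc a) (vtx P) (vtx Q)
    ; edg     = splice a (edg P) (f ◂ edg Q)
    ; vtx-inj = splice-injective (vtx-inj P) (vtx-inj Q) Pᵥ∩Qᵥ
    ; edg-inj = splice-injective (edg-inj P) (◂-injective (edg-inj Q) f∉Q) Pₑ∩fQₑ
    ; links   = splice-chain Links (links P) link (links Q)
    }

module PeriodicCycle {H : Hypergraph} {k : ℕ} (C : BergeCycle H (suc k)) where

  open SeqPath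

  pos : ℕ → Fin (suc k)
  pos t = t mod suc k

  c : ℕ → Fin (n H)
  c = cvtx C ∘ pos

  E : ℕ → Fin (m H)
  E = cedg C ∘ pos

  toℕ-pos : ∀ t → toℕ (pos t) ≡ t % suc k
  toℕ-pos t = toℕ-fromℕ< (m%n<n t (suc k))

  pos-toℕ : ∀ (i : Fin (suc k)) → pos (toℕ i) ≡ i
  pos-toℕ i = toℕ-injective (trans (toℕ-pos (toℕ i)) (m<n⇒m%n≡m (toℕ<n i)))

  c-toℕ : ∀ i → c (toℕ i) ≡ cvtx C i
  c-toℕ i = cong (cvtx C) (pos-toℕ i)

  E-toℕ : ∀ i → E (toℕ i) ≡ cedg C i
  E-toℕ i = cong (cedg C) (pos-toℕ i)

  toℕ-cnext : ∀ (i : Fin (suc k)) → toℕ (cnext i) ≡ suc (toℕ i) % suc k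
  toℕ-cnext i with suc (toℕ i) <? suc k
  ... | yes i+1<n = trans (toℕ-fromℕ< i+1<n) (sym (m<n⇒m%n≡m i+1<n))
  ... | no  i+1≮n =
    sym (trans (cong (_% suc k) (≤-antisym (toℕ<n i) (≮⇒≥ i+1≮n))) (n%n≡0 (suc k)))

  pos-suc : ∀ t → pos (suc t) ≡ cnext (pos t)
  pos-suc t = toℕ-injective (begin
    toℕ (pos (suc t))                       ≡⟨ toℕ-pos (suc t) ⟩
    (1 + t) % suc k                         ≡⟨ %-distribˡ-+ 1 t (suc k) ⟩
    (1 % suc k + t % suc k) % suc k         ≡⟨ cong (λ r → (1 % suc k + r) % suc k) (m%n%n≡m%n t (suc k)) ⟨
    (1 % suc k + t % suc k % suc k) % suc k ≡⟨ %-distribˡ-+ 1 (t % suc k) (suc k) ⟨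
    suc (t % suc k) % suc k                 ≡⟨ cong (λ r → suc r % suc k) (toℕ-pos t) ⟨
    suc (toℕ (pos t)) % suc k               ≡⟨ toℕ-cnext (pos t) ⟨
    toℕ (cnext (pos t))                     ∎)
    where open ≡-Reasoning

  c-periodic : ∀ t → c (suc k + t) ≡ c t
  c-periodic t = cong (cvtx C) (toℕ-injective (begin
    toℕ (pos (suc k + t))  ≡⟨ toℕ-pos (suc k + t) ⟩
    (suc k + t) % suc k    ≡⟨ cong (_% suc k) (+-comm (suc k) t) ⟩
    (t + suc k) % suc k    ≡⟨ [m+n]%n≡m%n t (suc k) ⟩
    t % suc k              ≡⟨ toℕ-pos t ⟨
    toℕ (pos t)            ∎))
    where open ≡-Reasoning

  c-links : ∀ t → Links H (c t) (E t) (c (suc t))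
  c-links t = let cₜ∈Eₜ , cₜ₊₁∈Eₜ = cinc C (pos t)
              in cₜ∈Eₜ , subst (λ i → cvtx C i ∈ edge H (E t)) (sym (pos-suc t)) cₜ₊₁∈Eₜ

  pos-offset-injective : ∀ s {a b} → a ≤ k → b ≤ k → pos (a + s) ≡ pos (b + s) → a ≡ b
  pos-offset-injective s {a} {b} a≤k b≤k eq = %-offset-injective (suc k) s (s≤s a≤k) (s≤s b≤k)
    (trans (sym (toℕ-pos (a + s))) (trans (cong toℕ eq) (toℕ-pos (b + s))))

  c-offset-injective : ∀ s {a b} → a ≤ k → b ≤ k → c (a + s) ≡ c (b + s) → a ≡ b
  c-offset-injective s a≤k b≤k = pos-offset-injective s a≤k b≤k ∘ cvtx-inj C

  E-offset-injective : ∀ s {a b} → a ≤ k → b ≤ k → E (a + s) ≡ E (b + s) → a ≡ b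
  E-offset-injective s a≤k b≤k = pos-offset-injective s a≤k b≤k ∘ cedg-inj C

  arc : ∀ s {l} → l ≤ k → SeqPath H l
  arc s l≤k = record
    { vtx     = λ t → c (t + s)
    ; edg     = λ t → E (t + s)
    ; vtx-inj = λ x< y< → c-offset-injective s (≤-trans (s≤s⁻¹ x<) l≤k) (≤-trans (s≤s⁻¹ y<) l≤k)
    ; edg-inj = λ x< y< → E-offset-injective s (≤-trans (<⇒≤ x<) l≤k) (≤-trans (<⇒≤ y<) l≤k)
    ; links   = λ {t} _ → c-links (t + s)
    }

  IsCycleEdge : Fin (m H) → Set
  IsCycleEdge f = ∃[ i ] cedg C i ≡ f

  cycle-edge? : ∀ f → Dec (IsCycleEdge f)
  cycle-edge? f = any? (λ i → cedg C i ≟ᶠ f)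

  on-cycle? : ∀ v → Dec (v ∈V C)
  on-cycle? v = any? (λ i → cvtx C i ≟ᶠ v)

  avoiding-arc : ∀ {f} j → cvtx C j ∈ edge H f →
                 ∃[ s ] c s ∈ edge H f × (∀ {r} → r < k → E (r + s) ≢ f)
  avoiding-arc {f} j cⱼ∈f with cycle-edge? f
  ... | no f∉C =
    toℕ j , subst (_∈ edge H f) (sym (c-toℕ j)) cⱼ∈f , λ {r} _ → f∉C ∘ (pos (r + toℕ j) ,_)
  ... | yes (i , Eᵢ≡f) =
    suc x , subst (λ g → c (suc x) ∈ edge H g) Eₓ≡f (proj₂ (c-links x)) , f∉arc
    where
    x : ℕ
    x = toℕ i
    Eₓ≡f : E x ≡ f
    Eₓ≡f = trans (E-toℕ i) Eᵢ≡f
    f∉arc : ∀ {r} → r < k → E (r + suc x) ≢ f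
    f∉arc {r} r<k eq = contradiction
      (E-offset-injective x r<k z≤n (trans (cong E (sym (+-suc r x))) (trans eq (sym Eₓ≡f))))
      (λ ())

  chord-path : ∀ {e} → ¬ IsCycleEdge e → ∀ i d L → L + suc d ≡ k →
               c i ∈ edge H e → c (d + suc i) ∈ edge H e →
               Σ (SeqPath H (L + suc d)) λ P → edg P L ≡ e
  chord-path {e} e∉C i d L L+1+d≡k cᵢ∈e cⱼ∈e =
      join H forward e backward vertices-apart edges-apart (λ {t} _ → E≢e (d ∸ suc t + suc i)) link
    , splice-at L
    where
    L≤k : L ≤ k
    L≤k = subst (L ≤_) L+1+d≡k (m≤m+n L (suc d))
    d≤k : d ≤ k
    d≤k = subst (d ≤_) L+1+d≡k (≤-trans (n≤1+n d) (m≤n+m (suc d) L))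

    forward : SeqPath H L
    forward = arc (suc d + suc i) L≤k
    backward : SeqPath H d
    backward = reverse H (arc (suc i) d≤k)

    E≢e : ∀ t → E t ≢ e
    E≢e t = e∉C ∘ (pos t ,_)

    forward-index : ∀ x → x + (suc d + suc i) ≡ x + suc d + suc i
    forward-index x = sym (+-assoc x (suc d) (suc i))

    forward-offset≤k : ∀ {x} → x ≤ L → x + suc d ≤ k
    forward-offset≤k x≤L = subst (_ ≤_) L+1+d≡k (+-monoˡ-≤ (suc d) x≤L)

    backward-offset≤k : ∀ y → d ∸ y ≤ k
    backward-offset≤k y = ≤-trans (m∸n≤m d y) d≤k

    offsets-apart : ∀ x y → x + suc d ≢ d ∸ y
    offsets-apart x y eq = <⇒≢ (<-≤-trans (s≤s (m∸n≤m d y)) (m≤n+m (suc d) x)) (sym eq)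

    vertices-apart : DisjointBelow (suc L) (vtx forward) (suc d) (vtx backward)
    vertices-apart {x} {y} x≤L _ eq = offsets-apart x y
      (c-offset-injective (suc i) (forward-offset≤k (s≤s⁻¹ x≤L)) (backward-offset≤k y)
        (trans (cong c (sym (forward-index x))) eq))

    edges-apart : DisjointBelow L (edg forward) (suc d) (e ◂ edg backward)
    edges-apart {x} {zero}  _   _  = E≢e (x + (suc d + suc i))
    edges-apart {x} {suc y} x<L _ eq = offsets-apart x (suc y)
      (E-offset-injective (suc i) (forward-offset≤k (<⇒≤ x<L)) (backward-offset≤k (suc y))
        (trans (cong E (sym (forward-index x))) eq))

    closes : c (L + (suc d + suc i)) ≡ c i
    closes = begin
      c (L + (suc d + suc i))  ≡⟨ cong c (forward-index L) ⟩
      c (L + suc d + suc i)    ≡⟨ cong (λ l → c (l + suc i)) L+1+d≡k ⟩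
      c (k + suc i)            ≡⟨ cong c (+-suc k i) ⟩
      c (suc k + i)            ≡⟨ c-periodic i ⟩
      c i                      ∎
      where open ≡-Reasoning

    link : Links H (c (L + (suc d + suc i))) e (c (d + suc i))
    link = subst (_∈ edge H e) (sym closes) cᵢ∈e , cⱼ∈e

  chord-through : ∀ {e} → ¬ IsCycleEdge e → ∀ a b → toℕ a < toℕ b →
                  cvtx C a ∈ edge H e → cvtx C b ∈ edge H e → Σ (BergePath H k) λ P → Uses P e
  chord-through {e} e∉C a b a<b cₐ∈e c_b∈e =
    subst (λ l → Σ (BergePath H l) λ P → Uses P e) L+1+d≡k
      (toBergePath H (proj₁ chord) , toBergePath-uses H (proj₁ chord) (m<m+n L z<s) (proj₂ chord))
    where
    i d L : ℕ
    i = toℕ a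
    d = proj₁ (m≤n⇒∃[o]m+o≡n a<b)
    1+i+d≡j : suc i + d ≡ toℕ b
    1+i+d≡j = proj₂ (m≤n⇒∃[o]m+o≡n a<b)
    1+d≤k : suc d ≤ k
    1+d≤k = ≤-trans (s≤s (m≤n+m d i)) (≤-trans (≤-reflexive 1+i+d≡j) (s≤s⁻¹ (toℕ<n b)))
    L = proj₁ (m≤n⇒∃[o]m+o≡n 1+d≤k)
    L+1+d≡k : L + suc d ≡ k
    L+1+d≡k = trans (+-comm L (suc d)) (proj₂ (m≤n⇒∃[o]m+o≡n 1+d≤k))
    cⱼ≡c_b : c (d + suc i) ≡ cvtx C b
    cⱼ≡c_b = trans (cong c (trans (+-comm d (suc i)) 1+i+d≡j)) (c-toℕ b)
    chord : Σ (SeqPath H (L + suc d)) λ P → edg P L ≡ e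
    chord = chord-path e∉C i d L L+1+d≡k (subst (_∈ edge H e) (sym (c-toℕ a)) cₐ∈e)
                                        (subst (_∈ edge H e) (sym cⱼ≡c_b) c_b∈e)

  module _ (longest : LongestPathLength H k) where

    no-exit : ∀ {u f} j → ¬ (u ∈V C) → Links H u f (cvtx C j) → ⊥
    no-exit {u} {f} j u∉C (u∈f , cⱼ∈f) =
      let s , cₛ∈f , f∉arc = avoiding-arc j cⱼ∈f
          P = prepend H u f (arc s ≤-refl) (λ {t} _ → u∉C ∘ (pos (t + s) ,_)) f∉arc (u∈f , cₛ∈f)
      in 1+n≰n (proj₂ longest (suc k) (toBergePath H P))

    all-on-cycle : Connected H → ∀ v → v ∈V C
    all-on-cycle conn v with on-cycle? v
    ... | yes v∈C = v∈C
    ... | no  v∉C =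
      let l , P , P₀≡v , Pₗ≡c₀ = conn v (cvtx C zero) (λ v≡c₀ → v∉C (zero , sym v≡c₀))
          i , Pᵢ∉C , j , cⱼ≡Pᵢ₊₁ = ∃-crossing (λ x → on-cycle? (vtx P x))
                                     (v∉C ∘ subst (_∈V C) P₀≡v) (zero , sym Pₗ≡c₀)
          Pᵢ∈eᵢ , Pᵢ₊₁∈eᵢ = inc P i
          cⱼ∈eᵢ = subst (_∈ edge H (edg P i)) (sym cⱼ≡Pᵢ₊₁) Pᵢ₊₁∈eᵢ
      in ⊥-elim (no-exit j Pᵢ∉C (Pᵢ∈eᵢ , cⱼ∈eᵢ))

    path-through : Connected H → ∀ e → Σ (BergePath H k) λ P → Uses P e
    path-through conn e with cycle-edge? e
    ... | yes (i , Eᵢ≡e) =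
      toBergePath H (arc (toℕ i) ≤-refl) ,
      toBergePath-uses H (arc (toℕ i) ≤-refl) (s≤s⁻¹ (len≥2 C)) (trans (E-toℕ i) Eᵢ≡e)
    ... | no e∉C with 1<∣p∣⇒∃≢ (edge H e) (edge-size H e)
    ... | x , y , x≢y , x∈e , y∈e with all-on-cycle conn x | all-on-cycle conn y
    ... | a , refl | b , refl with <-cmp (toℕ a) (toℕ b)
    ... | tri< a<b _ _ = chord-through e∉C a b a<b x∈e y∈e
    ... | tri≈ _ a≡b _ = contradiction (cong (cvtx C) (toℕ-injective a≡b)) x≢y
    ... | tri> _ _ b<a = chord-through e∉C b a b<a y∈e x∈e

lemma3p2 : (H : Hypergraph) (k : ℕ) → Connected H → LongestPathLength H k →
    (C : BergeCycle H (suc k)) →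
    (∀ (v : Fin (n H)) → v ∈V C) × (∀ (e : Fin (m H)) → pH≡ H e k)
lemma3p2 H k conn longest C =
  all-on-cycle longest conn , λ e → path-through longest conn e , λ l P _ → proj₂ longest l P
  where open PeriodicCycle C
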